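{- For every integer $k\ge 1$, there exists a numerical semigroup $S$ such that $\mathrm{B}(S)=\{7+2k,\,8+2k,\dots,7+4k\}$.
   Context: $\mathbb N=\{0,1,2,\dots\}$. A numerical semigroup is a subset $S\subseteq\mathbb N$ containing $0$, closed under addition, with finite complement. For a finite set $A\subset\mathbb Z$ and $n\ge1$, $nA$ is the $n$-fold sumset: $1A=A$, $nA=A+(n-1)A$, where $X+Y=\{x+y\mid x\in X, y\in Y\}$. For a numerical semigroup $S$ with gapset $G=\mathbb N\setminus S$, its Buchweitz set is $\mathrm{B}(S)=\{n\ge 2 \mid |nG| > (2n-1)(|G|-1)\}$. -}

module Defs where

open import Data.Nat using (ℕ; zero; suc; _+_; _≤_; _≟_)
open import Data.Integer as ℤ using (ℤ)
open import Data.List using (List; []; _∷_; length; deduplicate; concatMap; map)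
open import Data.List.Membership.Propositional using (_∈_; _∉_)
open import Data.List.Relation.Unary.Unique.Propositional using (Unique)
open import Data.Product using (_×_)

-- A numerical semigroup S ⊆ ℕ is determined by its (finite) gapset G = ℕ ∖ S.
-- We represent S by G, given as a duplicate-free list; S = { x | x ∉ G }.
record NumericalSemigroup : Set where
  field
    gaps     : List ℕ
    gapsUniq : Unique gaps
    zero∈S   : 0 ∉ gaps
    closed   : ∀ a b → a ∉ gaps → b ∉ gaps → (a + b) ∉ gaps
open NumericalSemigroup public

_∈S_ : ℕ → NumericalSemigroup → Set
x ∈S S = x ∉ gaps S

_⊕_ : List ℕ → List ℕ → List ℕ
X ⊕ Y = concatMap (λ x → map (x +_) Y) X

-- n-fold sumset: 1A = A, nA = A + (n-1)A   (0A := {0}, never used)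
_·_ : ℕ → List ℕ → List ℕ
zero · A = 0 ∷ []
suc zero · A = A
suc (suc n) · A = A ⊕ (suc n · A)

card : List ℕ → ℕ
card X = length (deduplicate _≟_ X)

InBuchweitz : NumericalSemigroup → ℕ → Set
InBuchweitz S n =
  (2 ≤ n) ×
  (((ℤ.+ 2) ℤ.* (ℤ.+ n) ℤ.- ℤ.+ 1) ℤ.* (ℤ.+ card (gaps S) ℤ.- ℤ.+ 1) ℤ.< ℤ.+ card (n · gaps S))

{-# OPTIONS --safe #-}
-- Put w = 6 + 2k, u = 2w + 1, X = u + w, and choose c > w with m = c + 4w, R = c + X, P = m + c
-- and F = m + R.  The semigroup with gap set G = [1, m) ∪ [P, P + w] ∪ {F} has gaps above m
-- F − d, d ∈ D = {0} ∪ [u, X].  Because F + 2 ≤ 2m, the sums of n ≥ 1 gaps are exactly the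
-- interval [n, (n−1)F + m) together with the numbers nF − d for d ∈ nD, and
-- nD = {0} ∪ [u, X] ∪ [2u, nX] since the intervals [ju, jX] overlap from j = 2 on.  As
-- (n−1)F + m = nF − R, only the d ≤ R contribute new elements, so for n ≥ 2 counting gives
--   |nG| − (2n − 1)(|G| − 1) = min(nX, R) − (3n + 1)w,
-- which is positive iff w < n and (3n + 1)w < R.  With c = w(19 + 12k) the last condition
-- reads n ≤ 7 + 4k.
module Submission where

open import Defs
open import Data.Nat using (ℕ; _+_; _*_; _≤_)
open import Data.Product using (Σ; _×_)
open import Function.Bundles using (_⇔_)

open import Data.Nat
open import Data.Nat.Properties
open import Algebra.Properties.CommutativeSemigroup +-commutativeSemigroup using (interchange)
open import Data.Nat.Tactic.RingSolver using (solve-∀)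
open import Data.Integer as ℤ using (+<+)
open import Data.Integer.Properties using (drop‿+<+; pos-*)
open import Data.List using (List; []; _∷_; _++_; length; map; applyUpTo)
open import Data.List.Properties using (length-applyUpTo; length-++; length-map)
open import Data.List.Membership.Propositional using (_∈_; _∉_; find)
open import Data.List.Membership.Propositional.Properties
  using (∈-applyUpTo⁺; ∈-applyUpTo⁻; ∈-map⁺; ∈-map⁻; ∈-concatMap⁺; ∈-concatMap⁻; deduplicate-∈⇔;
         ∈-++⁺ˡ; ∈-++⁺ʳ; ∈-++⁻)
open import Data.List.Membership.Propositional.Properties.WithK using (unique∧set⇒bag)
open import Data.List.Relation.Unary.All as All using (All; []; _∷_)
import Data.List.Relation.Unary.All.Properties as All
import Data.List.Relation.Unary.Any as Any
open import Data.List.Relation.Unary.Any using (here; there)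
open import Data.List.Relation.Unary.AllPairs using ([]; _∷_)
open import Data.List.Relation.Unary.Unique.Propositional using (Unique)
open import Data.List.Relation.Unary.Unique.Propositional.Properties using (applyUpTo⁺₁; ++⁺)
open import Data.List.Relation.Unary.Unique.DecPropositional.Properties _≟_ using (deduplicate-!)
open import Data.List.Relation.Binary.BagAndSetEquality using (∼bag⇒↭)
open import Data.List.Relation.Binary.Disjoint.Propositional using (Disjoint)
open import Data.List.Relation.Binary.Permutation.Propositional.Properties using (↭-length)
open import Data.List.Relation.Binary.Subset.Propositional using (_⊆_)
open import Data.Product using (_,_; ∃; ∃₂; proj₁; proj₂)
open import Data.Product.Function.NonDependent.Propositional using (_×-⇔_)
open import Data.Sum using (_⊎_; inj₁; inj₂)
open import Function.Base using (_∘′_)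
open import Function.Bundles using (mk⇔)
open import Function.Construct.Composition using (_⇔-∘_)
open import Function.Construct.Identity using (⇔-id)
open import Function.Construct.Symmetry using (⇔-sym)
open import Function.Related.Propositional using (module EquationalReasoning)
open import Relation.Nullary using (yes; no; contradiction)
open import Relation.Binary.PropositionalEquality

x+[e+d]≡[a+e]+b⇒x≡a+[b∸d] : ∀ {x e d a b} → x + (e + d) ≡ (a + e) + b → d ≤ b → x ≡ a + (b ∸ d)
x+[e+d]≡[a+e]+b⇒x≡a+[b∸d] {x} {e} {d} {a} {b} eq d≤b = +-cancelʳ-≡ (e + d) x (a + (b ∸ d)) (begin
  x + (e + d)             ≡⟨ eq ⟩
  (a + e) + b             ≡⟨ cong ((a + e) +_) (sym (m∸n+n≡m d≤b)) ⟩
  (a + e) + (b ∸ d + d)   ≡⟨ interchange a e (b ∸ d) d ⟩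
  (a + (b ∸ d)) + (e + d) ∎)
  where open ≡-Reasoning

a+c≡b+d⇒b<a⇔c<d : ∀ {a b c d} → a + c ≡ b + d → (b < a ⇔ c < d)
a+c≡b+d⇒b<a⇔c<d {a} {b} {c} {d} eq = mk⇔
  (λ b<a → +-cancelˡ-< b c d (subst (b + c <_) eq (+-monoˡ-< c b<a)))
  (λ c<d → +-cancelʳ-< c b a (subst (b + c <_) (sym eq) (+-monoʳ-< b c<d)))

<-⊓⇔ : ∀ {x m n} → x < m ⊓ n ⇔ (x < m × x < n)
<-⊓⇔ {m = m} {n} = mk⇔
  (λ x<m⊓n → ≤-trans x<m⊓n (m⊓n≤m m n) , ≤-trans x<m⊓n (m⊓n≤n m n))
  (λ (x<m , x<n) → ⊓-glb x<m x<n)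

-- Finite sets of naturals as lists

interval : ℕ → ℕ → List ℕ
interval a b = applyUpTo (a +_) (b ∸ a)

∈-interval⁺ : ∀ {a b x} → a ≤ x → x < b → x ∈ interval a b
∈-interval⁺ {a} {b} a≤x x<b = subst (_∈ interval a b) (m+[n∸m]≡n a≤x)
  (∈-applyUpTo⁺ (a +_) (∸-monoˡ-< x<b a≤x))

∈-interval⁻ : ∀ a b {x} → x ∈ interval a b → a ≤ x × x < b
∈-interval⁻ a b x∈ with ∈-applyUpTo⁻ (a +_) x∈
... | i , i<b∸a , refl = m≤m+n a i , subst (a + i <_) (m+[n∸m]≡n a≤b) (+-monoʳ-< a i<b∸a)
  where
  a≤b : a ≤ b
  a≤b = <⇒≤ (m∸n≢0⇒n<m λ b∸a≡0 → n≮0 (subst (i <_) b∸a≡0 i<b∸a))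

interval-unique : ∀ a b → Unique (interval a b)
interval-unique a b = applyUpTo⁺₁ (a +_) (b ∸ a) λ i<j _ → <⇒≢ i<j ∘′ +-cancelˡ-≡ a _ _

length-interval : ∀ a b → length (interval a b) ≡ b ∸ a
length-interval a b = length-applyUpTo (a +_) (b ∸ a)

∈-⊕⁺ : ∀ {X Y a b} → a ∈ X → b ∈ Y → a + b ∈ X ⊕ Y
∈-⊕⁺ {Y = Y} a∈X b∈Y =
  ∈-concatMap⁺ (λ a → map (a +_) Y) (Any.map (λ { refl → ∈-map⁺ (_ +_) b∈Y }) a∈X)

∈-⊕⁻ : ∀ X Y {x} → x ∈ X ⊕ Y → ∃₂ λ a b → a ∈ X × b ∈ Y × x ≡ a + b
∈-⊕⁻ X Y x∈ with find (∈-concatMap⁻ (λ a → map (a +_) Y) {xs = X} x∈)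
... | a , a∈X , x∈a+Y with ∈-map⁻ (a +_) x∈a+Y
... | b , b∈Y , x≡a+b = a , b , a∈X , b∈Y , x≡a+b

card-≡-length : ∀ {xs ys : List ℕ} → Unique ys → (∀ {x} → x ∈ xs ⇔ x ∈ ys) → card xs ≡ length ys
card-≡-length {xs} ys! xs≈ys = ↭-length (∼bag⇒↭ (unique∧set⇒bag (deduplicate-! xs) ys!
  (xs≈ys ⇔-∘ ⇔-sym (deduplicate-∈⇔ _≟_))))

map-∸-unique : ∀ {n ds} → All (_≤ n) ds → Unique ds → Unique (map (n ∸_) ds)
map-∸-unique [] [] = []
map-∸-unique (d≤n ∷ ds≤n) (d∉ds ∷ ds!) =
  All.map⁺ (All.zipWith (λ (e≤n , d≢e) → d≢e ∘′ ∸-cancelˡ-≡ d≤n e≤n) (ds≤n , d∉ds))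
  ∷ map-∸-unique ds≤n ds!

-- Sumsets of gap sets

sumset-≥ : ∀ {G} → (∀ {a} → a ∈ G → 1 ≤ a) → ∀ n {x} → x ∈ suc n · G → suc n ≤ x
sumset-≥ G≥1 zero    x∈ = G≥1 x∈
sumset-≥ {G} G≥1 (suc n) x∈ with ∈-⊕⁻ G (suc n · G) x∈
... | a , y , a∈G , y∈nG , refl = +-mono-≤ (G≥1 a∈G) (sumset-≥ G≥1 n y∈nG)

module _ {G : List ℕ} {m F : ℕ} (low⊆G : interval 1 m ⊆ G) (F∈G : F ∈ G)
         (1≤F : 1 ≤ F) (F+2≤m+m : F + 2 ≤ m + m) where

  private
    n≤n*F : ∀ n → n ≤ n * F
    n≤n*F n = subst (_≤ n * F) (*-identityʳ n) (*-monoʳ-≤ n 1≤F)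

    [1+o]+[1+n]≡2+n+o : ∀ o n → suc o + suc n ≡ suc (suc n) + o
    [1+o]+[1+n]≡2+n+o o n = cong suc (+-comm o (suc n))

    p+[2+n+o]≡1+p+[1+n]+o : ∀ p n o → p + (suc (suc n) + o) ≡ suc p + suc n + o
    p+[2+n+o]≡1+p+[1+n]+o = solve-∀

    m+[1+n]+o≡m+o+[1+n] : ∀ m n o → m + suc n + o ≡ m + o + suc n
    m+[1+n]+o≡m+o+[1+n] = solve-∀

    [1+m+o]+2≡m+[o+3] : ∀ m o → suc (m + o) + 2 ≡ m + (o + 3)
    [1+m+o]+2≡m+[o+3] = solve-∀

    n+[o+3]≡3+n+o : ∀ n o → n + (o + 3) ≡ suc (suc (suc n) + o)
    n+[o+3]≡3+n+o = solve-∀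

  -- Split off F if x ≥ F + n, and otherwise the gap x − n or m − 1 below m; F + 2 ≤ 2m keeps the
  -- remaining summand below (n − 1)F + m.
  interval⊆sumset : ∀ n {x} → suc n ≤ x → x < n * F + m → x ∈ suc n · G
  interval⊆sumset zero n<x x<m = low⊆G (∈-interval⁺ n<x x<m)
  interval⊆sumset (suc n) {x} n<x x<L with F + suc n ≤? x | x <? m + suc n
  ... | yes F+n≤x | _ with m≤n⇒∃[o]m+o≡n F+n≤x
  ...   | o , refl = subst (_∈ suc (suc n) · G) (sym (+-assoc F (suc n) o))
                       (∈-⊕⁺ F∈G (interval⊆sumset n (m≤m+n (suc n) o) y<L))
    where
    y<L : suc n + o < n * F + m
    y<L = +-cancelˡ-< F _ _ (subst₂ _<_ (+-assoc F (suc n) o) (+-assoc F (n * F) m) x<L)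
  interval⊆sumset (suc n) {x} n<x x<L | no _ | yes x<m+n with m≤n⇒∃[o]m+o≡n n<x
  ...   | o , refl = subst (_∈ suc (suc n) · G) ([1+o]+[1+n]≡2+n+o o n)
                       (∈-⊕⁺ (low⊆G (∈-interval⁺ (s≤s z≤n) a<m)) (interval⊆sumset n ≤-refl n<L))
    where
    a<m : suc o < m
    a<m = +-cancelʳ-< (suc n) (suc o) m (subst (_< m + suc n) (sym ([1+o]+[1+n]≡2+n+o o n)) x<m+n)
    n<L : suc n < n * F + m
    n<L = subst (_≤ n * F + m) (+-comm n 2) (+-mono-≤ (n≤n*F n) (≤-trans (s≤s (s≤s z≤n)) a<m))
  interval⊆sumset (suc n) {x} n<x x<L | no x≮F+n | no m+n≰x with m≤n⇒∃[o]m+o≡n (≮⇒≥ m+n≰x)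
  ...   | o , refl = subst (_∈ suc (suc n) · G) x≡a+y
                       (∈-⊕⁺ (low⊆G (∈-interval⁺ 1≤pred-m pred[m]<m)) (interval⊆sumset n y>n y<L))
    where
    m+o<F : m + o < F
    m+o<F = +-cancelʳ-< (suc n) (m + o) F (subst (_< F + suc n) (m+[1+n]+o≡m+o+[1+n] m n o) (≰⇒> x≮F+n))
    o+3≤m : o + 3 ≤ m
    o+3≤m = +-cancelˡ-≤ m (o + 3) m
      (subst (_≤ m + m) ([1+m+o]+2≡m+[o+3] m o) (≤-trans (+-monoˡ-≤ 2 m+o<F) F+2≤m+m))
    2≤m : 2 ≤ m
    2≤m = ≤-trans (m≤n+m 2 (suc o)) (subst (_≤ m) (+-suc o 2) o+3≤m)
    instance
      m≢0 : NonZero m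
      m≢0 = >-nonZero (≤-trans (s≤s z≤n) 2≤m)
    x≡a+y : pred m + (suc (suc n) + o) ≡ m + suc n + o
    x≡a+y = trans (p+[2+n+o]≡1+p+[1+n]+o (pred m) n o) (cong (λ z → z + suc n + o) (suc-pred m))
    1≤pred-m : 1 ≤ pred m
    1≤pred-m = <⇒≤pred 2≤m
    pred[m]<m : pred m < m
    pred[m]<m = subst (pred m <_) (suc-pred m) ≤-refl
    y>n : suc n ≤ suc (suc n) + o
    y>n = ≤-trans (n≤1+n (suc n)) (m≤m+n (suc (suc n)) o)
    y<L : suc (suc n) + o < n * F + m
    y<L = subst (_≤ n * F + m) (n+[o+3]≡3+n+o n o) (+-mono-≤ (n≤n*F n) o+3≤m)

module _ {G : List ℕ} {m : ℕ} (G! : Unique G) (G≥1 : ∀ {a} → a ∈ G → 1 ≤ a)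
         (low⊆G : interval 1 m ⊆ G) (G<m+m : ∀ {a} → a ∈ G → a < m + m) where

  private
    nonGap≥m : ∀ {a} → a ∉ G → 1 ≤ a → m ≤ a
    nonGap≥m {a} a∉G 1≤a with m ≤? a
    ... | yes m≤a = m≤a
    ... | no  m≰a = contradiction (low⊆G (∈-interval⁺ 1≤a (≰⇒> m≰a))) a∉G

    nonGaps-closed : ∀ a b → a ∉ G → b ∉ G → a + b ∉ G
    nonGaps-closed zero    b       _   b∉G = b∉G
    nonGaps-closed (suc a) zero    a∉G _   = subst (_∉ G) (sym (+-identityʳ (suc a))) a∉G
    nonGaps-closed (suc a) (suc b) a∉G b∉G a+b∈G = <⇒≱ (G<m+m a+b∈G)
      (+-mono-≤ (nonGap≥m a∉G (s≤s z≤n)) (nonGap≥m b∉G (s≤s z≤n)))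

  semigroupWithGaps : NumericalSemigroup
  semigroupWithGaps = record
    { gaps     = G
    ; gapsUniq = G!
    ; zero∈S   = λ 0∈G → contradiction (G≥1 0∈G) λ ()
    ; closed   = nonGaps-closed
    }

inBuchweitz⇔bound<card : ∀ S n {g} → card (gaps S) ≡ suc g →
                         InBuchweitz S (2 + n) ⇔ suc (2 * suc n) * g < card ((2 + n) · gaps S)
inBuchweitz⇔bound<card S n {g} |G|≡1+g = mk⇔
  (λ (_ , bound<|nG|) → drop‿+<+ (subst (ℤ._< |nG|) bound≡ bound<|nG|))
  (λ bound<|nG| → s≤s (s≤s z≤n) , subst (ℤ._< |nG|) (sym bound≡) (+<+ bound<|nG|))
  where
  |nG| : ℤ.ℤ
  |nG| = ℤ.+ card ((2 + n) · gaps S)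
  bound≡ : ((ℤ.+ 2) ℤ.* (ℤ.+ (2 + n)) ℤ.- ℤ.+ 1) ℤ.* (ℤ.+ card (gaps S) ℤ.- ℤ.+ 1)
         ≡ ℤ.+ (suc (2 * suc n) * g)
  bound≡ rewrite |G|≡1+g =
    trans (sym (pos-* (2 * (2 + n) ∸ 1) g)) (cong (λ k → ℤ.+ (k * g)) (cong suc (+-suc n (suc (n + 0)))))

-- The construction

module Construction (w c : ℕ) (3≤w : 3 ≤ w) (w<c : w < c) where

  u X m R P F : ℕ
  u = suc (2 * w)
  X = u + w
  m = c + 4 * w
  R = c + X
  P = m + c
  F = P + X

  F≡m+R : F ≡ m + R
  F≡m+R = +-assoc m c X

  u≤X : u ≤ X
  u≤X = m≤m+n u w

  X<u+u : X < u + u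
  X<u+u = +-monoʳ-< u (s≤s (m≤m+n w (w + 0)))

  X≤R : X ≤ R
  X≤R = m≤n+m X c

  R≤F : R ≤ F
  R≤F = subst (R ≤_) (sym F≡m+R) (m≤n+m R m)

  X≤F : X ≤ F
  X≤F = ≤-trans X≤R R≤F

  m≤F : m ≤ F
  m≤F = subst (m ≤_) (sym F≡m+R) (m≤m+n m R)

  1≤m : 1 ≤ m
  1≤m = ≤-trans (s≤s z≤n) (≤-trans w<c (m≤m+n c (4 * w)))

  1≤P : 1 ≤ P
  1≤P = ≤-trans (s≤s z≤n) (≤-trans w<c (m≤n+m c m))

  1≤F : 1 ≤ F
  1≤F = ≤-trans 1≤P (m≤m+n P X)

  F+2≤m+m : F + 2 ≤ m + m
  F+2≤m+m = begin
    F + 2        ≡⟨ +-assoc P X 2 ⟩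
    P + (X + 2)  ≤⟨ +-monoʳ-≤ P X+2≤4w ⟩
    P + 4 * w    ≡⟨ +-assoc m c (4 * w) ⟩
    m + m        ∎
    where
    open ≤-Reasoning
    3+3w≡X+2 : ∀ w → 3 + 3 * w ≡ suc (2 * w) + w + 2
    3+3w≡X+2 = solve-∀
    w+3w≡4w : ∀ w → w + 3 * w ≡ 4 * w
    w+3w≡4w = solve-∀
    X+2≤4w : X + 2 ≤ 4 * w
    X+2≤4w = subst₂ _≤_ (3+3w≡X+2 w) (w+3w≡4w w) (+-monoˡ-≤ (3 * w) 3≤w)

  u+u≤R : u + u ≤ R
  u+u≤R = subst (_≤ R) (1+w+X≡u+u w) (+-monoˡ-≤ X w<c)
    where
    1+w+X≡u+u : ∀ w → suc w + (suc (2 * w) + w) ≡ suc (2 * w) + suc (2 * w)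
    1+w+X≡u+u = solve-∀

  gapList : List ℕ
  gapList = interval 1 m ++ interval P (suc (P + w)) ++ F ∷ []

  -- Deficit₁ d and Deficit n d say d ∈ D and d ∈ nD, where D = {0} ∪ [u, X].
  Deficit₁ : ℕ → Set
  Deficit₁ d = d ≡ 0 ⊎ (u ≤ d × d ≤ X)

  Deficit : ℕ → ℕ → Set
  Deficit n d = Deficit₁ d ⊎ (u + u ≤ d × d ≤ n * X)

  deficit₁-≤ : ∀ {d} → Deficit₁ d → d ≤ X
  deficit₁-≤ (inj₁ refl)      = z≤n
  deficit₁-≤ (inj₂ (_ , d≤X)) = d≤X

  deficit₁-complement-≥P : ∀ {x d} → Deficit₁ d → x + d ≡ F → P ≤ x
  deficit₁-complement-≥P {x} {d} d₁ x+d≡F =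
    +-cancelʳ-≤ X P x (subst (_≤ x + X) x+d≡F (+-monoʳ-≤ x (deficit₁-≤ d₁)))

  low⊆gaps : interval 1 m ⊆ gapList
  low⊆gaps = ∈-++⁺ˡ

  F∈gaps : F ∈ gapList
  F∈gaps = ∈-++⁺ʳ (interval 1 m) (∈-++⁺ʳ (interval P (suc (P + w))) (here refl))

  complement∈gaps : ∀ {x d} → Deficit₁ d → x + d ≡ F → x ∈ gapList
  complement∈gaps {x} (inj₁ refl) x+0≡F = subst (_∈ gapList) (trans (sym x+0≡F) (+-identityʳ x)) F∈gaps
  complement∈gaps {x} {d} d₁@(inj₂ (u≤d , _)) x+d≡F =
    ∈-++⁺ʳ (interval 1 m) (∈-++⁺ˡ (∈-interval⁺ (deficit₁-complement-≥P d₁ x+d≡F) (s≤s x≤P+w)))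
    where
    F≡P+w+u : F ≡ P + w + u
    F≡P+w+u = trans (cong (P +_) (+-comm u w)) (sym (+-assoc P w u))
    x≤P+w : x ≤ P + w
    x≤P+w = +-cancelʳ-≤ u x (P + w) (subst (x + u ≤_) (trans x+d≡F F≡P+w+u) (+-monoʳ-≤ x u≤d))

  gap⁻ : ∀ {x} → x ∈ gapList → (1 ≤ x × x < m) ⊎ ∃ λ d → Deficit₁ d × x + d ≡ F
  gap⁻ x∈G with ∈-++⁻ (interval 1 m) x∈G
  ... | inj₁ x∈low = inj₁ (∈-interval⁻ 1 m x∈low)
  ... | inj₂ x∈high with ∈-++⁻ (interval P (suc (P + w))) x∈high
  ...   | inj₂ (here refl) = inj₂ (0 , inj₁ refl , +-identityʳ F)
  ...   | inj₁ x∈mid with ∈-interval⁻ P _ x∈mid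
  ...     | P≤x , x≤P+w with m≤n⇒∃[o]m+o≡n P≤x
  ...       | e , refl with m≤n⇒∃[o]m+o≡n (+-cancelˡ-≤ P e w (s≤s⁻¹ x≤P+w))
  ...         | f , e+f≡w = inj₂ (f + u , inj₂ (m≤n+m u f , f+u≤X) , P+e+[f+u]≡F)
    where
    f+u≤X : f + u ≤ X
    f+u≤X = subst (f + u ≤_) (+-comm w u) (+-monoˡ-≤ u (subst (f ≤_) e+f≡w (m≤n+m f e)))
    regroup : ∀ P e f u → P + e + (f + u) ≡ P + (u + (e + f))
    regroup = solve-∀
    P+e+[f+u]≡F : P + e + (f + u) ≡ F
    P+e+[f+u]≡F = trans (regroup P e f u) (cong (λ z → P + (u + z)) e+f≡w)

  gap≥1 : ∀ {x} → x ∈ gapList → 1 ≤ x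
  gap≥1 x∈G with gap⁻ x∈G
  ... | inj₁ (1≤x , _)         = 1≤x
  ... | inj₂ (_ , d₁ , x+d≡F) = ≤-trans 1≤P (deficit₁-complement-≥P d₁ x+d≡F)

  gap≤F : ∀ {x} → x ∈ gapList → x ≤ F
  gap≤F {x} x∈G with gap⁻ x∈G
  ... | inj₁ (_ , x<m)         = ≤-trans (<⇒≤ x<m) m≤F
  ... | inj₂ (d , _ , x+d≡F) = subst (x ≤_) x+d≡F (m≤m+n x d)

  gaps-unique : Unique gapList
  gaps-unique = ++⁺ (interval-unique 1 m) (++⁺ (interval-unique P _) (All.[] ∷ []) mid∩top) low∩high
    where
    w<X : w < X
    w<X = s≤s (m≤n+m w (2 * w))
    mid∩top : Disjoint (interval P (suc (P + w))) (F ∷ [])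
    mid∩top (F∈mid , here refl) = <⇒≱ (+-monoʳ-< P w<X) (s≤s⁻¹ (proj₂ (∈-interval⁻ P _ F∈mid)))
    high≥P : ∀ {x} → x ∈ interval P (suc (P + w)) ++ F ∷ [] → P ≤ x
    high≥P x∈high with ∈-++⁻ (interval P (suc (P + w))) x∈high
    ... | inj₁ x∈mid       = proj₁ (∈-interval⁻ P _ x∈mid)
    ... | inj₂ (here refl) = m≤m+n P X
    low∩high : Disjoint (interval 1 m) (interval P (suc (P + w)) ++ F ∷ [])
    low∩high (x∈low , x∈high) =
      <⇒≱ (proj₂ (∈-interval⁻ 1 m x∈low)) (≤-trans (m≤m+n m c) (high≥P x∈high))

  |gaps|≡1+m+w : card gapList ≡ suc (m + w)
  |gaps|≡1+m+w = begin
    card gapList                                    ≡⟨ card-≡-length gaps-unique (⇔-id _) ⟩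
    length gapList                                  ≡⟨ length-++ (interval 1 m) ⟩
    length (interval 1 m) + length (interval P (suc (P + w)) ++ F ∷ [])
      ≡⟨ cong (length (interval 1 m) +_) (length-++ (interval P _)) ⟩
    length (interval 1 m) + (length (interval P (suc (P + w))) + 1)
      ≡⟨ cong₂ (λ a b → a + (b + 1)) (length-interval 1 m) (length-interval P _) ⟩
    (m ∸ 1) + ((suc (P + w) ∸ P) + 1)               ≡⟨ cong (λ z → (m ∸ 1) + (z + 1)) |mid|≡1+w ⟩
    (m ∸ 1) + (suc w + 1)                           ≡⟨ regroup (m ∸ 1) w ⟩
    (m ∸ 1) + 1 + suc w                             ≡⟨ cong (_+ suc w) (m∸n+n≡m 1≤m) ⟩
    m + suc w                                       ≡⟨ +-suc m w ⟩
    suc (m + w)                                     ∎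
    where
    open ≡-Reasoning
    |mid|≡1+w : suc (P + w) ∸ P ≡ suc w
    |mid|≡1+w = trans (cong (_∸ P) (sym (+-suc P w))) (m+n∸m≡n P (suc w))
    regroup : ∀ a w → a + (suc w + 1) ≡ a + 1 + suc w
    regroup = solve-∀

  semigroup : NumericalSemigroup
  semigroup = semigroupWithGaps {m = m} gaps-unique gap≥1 low⊆gaps gap<m+m
    where
    gap<m+m : ∀ {x} → x ∈ gapList → x < m + m
    gap<m+m x∈G =
      ≤-trans (s≤s (gap≤F x∈G)) (≤-trans (n≤1+n (suc F)) (subst (_≤ m + m) (+-comm F 2) F+2≤m+m))

  deficit-≤ : ∀ n {d} → Deficit (suc n) d → d ≤ suc n * X
  deficit-≤ n (inj₁ d₁)         = ≤-trans (deficit₁-≤ d₁) (m≤m+n X (n * X))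
  deficit-≤ n (inj₂ (_ , d≤nX)) = d≤nX

  deficit₁-of-1 : ∀ {d} → Deficit 1 d → Deficit₁ d
  deficit₁-of-1     (inj₁ d₁)                = d₁
  deficit₁-of-1 {d} (inj₂ (u+u≤d , d≤X+0)) =
    contradiction (≤-trans u+u≤d (subst (d ≤_) (+-identityʳ X) d≤X+0)) (<⇒≱ X<u+u)

  deficit-intro : ∀ n {d} → u ≤ d → d ≤ suc n * X → (1 ≤ n → u + u ≤ d) → Deficit (suc n) d
  deficit-intro zero {d} u≤d d≤X+0 _  = inj₁ (inj₂ (u≤d , subst (d ≤_) (+-identityʳ X) d≤X+0))
  deficit-intro (suc n) _   d≤nX  2u≤ = inj₂ (2u≤ (s≤s z≤n) , d≤nX)

  deficit-step⁺ : ∀ n {e d} → Deficit₁ e → Deficit (suc n) d → Deficit (suc (suc n)) (e + d)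
  deficit-step⁺ n (inj₁ refl) (inj₁ d₁)              = inj₁ d₁
  deficit-step⁺ n (inj₁ refl) (inj₂ (u+u≤d , d≤nX)) = inj₂ (u+u≤d , ≤-trans d≤nX (m≤n+m _ X))
  deficit-step⁺ n {e} e₁@(inj₂ _) (inj₁ (inj₁ refl)) = inj₁ (subst Deficit₁ (sym (+-identityʳ e)) e₁)
  deficit-step⁺ n (inj₂ (u≤e , e≤X)) (inj₁ (inj₂ (u≤d , d≤X))) =
    inj₂ (+-mono-≤ u≤e u≤d , +-mono-≤ e≤X (≤-trans d≤X (m≤m+n X (n * X))))
  deficit-step⁺ n {e} {d} (inj₂ (_ , e≤X)) (inj₂ (u+u≤d , d≤nX)) =
    inj₂ (≤-trans u+u≤d (m≤n+m d e) , +-mono-≤ e≤X d≤nX)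

  deficit-step⁻ : ∀ n {d} → Deficit (suc (suc n)) d →
                  ∃₂ λ e d′ → Deficit₁ e × Deficit (suc n) d′ × d ≡ e + d′
  deficit-step⁻ n {d} (inj₁ d₁) = d , 0 , d₁ , inj₁ (inj₁ refl) , sym (+-identityʳ d)
  deficit-step⁻ n {d} (inj₂ (u+u≤d , d≤)) with d ≤? suc n * X
  ... | yes d≤nX = 0 , d , inj₁ refl , inj₂ (u+u≤d , d≤nX) , refl
  ... | no  d≰nX with d ≤? u + suc n * X | m≤n⇒∃[o]m+o≡n (≤-trans (m≤m+n u u) u+u≤d)
  ...   | yes d≤u+nX | d′ , refl = u , d′ , inj₂ (≤-refl , u≤X) ,
            deficit-intro n (+-cancelˡ-≤ u u d′ u+u≤d) (+-cancelˡ-≤ u d′ _ d≤u+nX) u+u≤d′ , refl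
    where
    3u≡1+2X : ∀ w → suc (2 * (suc (2 * w) + w)) ≡ suc (2 * w) + (suc (2 * w) + suc (2 * w))
    3u≡1+2X = solve-∀
    u+u≤d′ : 1 ≤ n → u + u ≤ d′
    u+u≤d′ 1≤n = +-cancelˡ-≤ u (u + u) d′ (subst (_≤ u + d′) (3u≡1+2X w)
      (≤-trans (s≤s (*-monoˡ-≤ X (s≤s 1≤n))) (≰⇒> d≰nX)))
  ...   | no d≰u+nX | _ with m≤n⇒∃[o]m+o≡n (≤-trans (<⇒≤ X<u+u) u+u≤d)
  ...     | d′ , refl = X , d′ , inj₂ (u≤X , ≤-refl) ,
              deficit-intro n u≤d′ (+-cancelˡ-≤ X d′ _ d≤) u+u≤d′ , refl
    where
    u+nX<X+d′ : u + suc n * X < X + d′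
    u+nX<X+d′ = ≰⇒> d≰u+nX
    u≤d′ : u ≤ d′
    u≤d′ = <⇒≤ (+-cancelˡ-< X u d′ (subst (_< X + d′) (+-comm u X)
      (≤-trans (s≤s (+-monoʳ-≤ u (m≤m+n X (n * X)))) u+nX<X+d′)))
    regroup : ∀ u X → u + 2 * X ≡ X + (u + X)
    regroup = solve-∀
    u+u≤d′ : 1 ≤ n → u + u ≤ d′
    u+u≤d′ 1≤n = ≤-trans (+-monoʳ-≤ u u≤X) (<⇒≤ (+-cancelˡ-< X (u + X) d′
      (subst (_< X + d′) (regroup u X) (≤-trans (s≤s (+-monoʳ-≤ u (*-monoˡ-≤ X (s≤s 1≤n)))) u+nX<X+d′))))

  sumset-cases : ∀ n {x} → x ∈ suc n · gapList →
                 x < n * F + m ⊎ ∃ λ d → Deficit (suc n) d × x + d ≡ suc n * F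
  sumset-cases zero x∈G with gap⁻ x∈G
  ... | inj₁ (_ , x<m)         = inj₁ x<m
  ... | inj₂ (d , d₁ , x+d≡F) = inj₂ (d , inj₁ d₁ , trans x+d≡F (sym (*-identityˡ F)))
  sumset-cases (suc n) x∈ with ∈-⊕⁻ gapList (suc n · gapList) x∈
  ... | a , y , a∈G , y∈nG , refl with sumset-cases n y∈nG
  ...   | inj₁ y<L = inj₁ (subst (a + y <_) (sym (+-assoc F (n * F) m)) (+-mono-≤-< (gap≤F a∈G) y<L))
  ...   | inj₂ (d , dᵢ , y+d≡nF) with gap⁻ a∈G
  ...     | inj₁ (_ , a<m) =
              inj₁ (subst (a + y <_) (+-comm m _) (+-mono-<-≤ a<m (subst (y ≤_) y+d≡nF (m≤m+n y d))))
  ...     | inj₂ (e , e₁ , a+e≡F) =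
              inj₂ (e + d , deficit-step⁺ n e₁ dᵢ , trans (interchange a y e d) (cong₂ _+_ a+e≡F y+d≡nF))

  deficit⊆sumset : ∀ n {x d} → Deficit (suc n) d → x + d ≡ suc n * F → x ∈ suc n · gapList
  deficit⊆sumset zero    dᵢ x+d≡F = complement∈gaps (deficit₁-of-1 dᵢ) (trans x+d≡F (*-identityˡ F))
  deficit⊆sumset (suc n) {x} dᵢ x+d≡F with deficit-step⁻ n dᵢ
  ... | e , d , e₁ , dᵢ′ , refl =
        subst (_∈ suc (suc n) · gapList) (sym x≡a+y)
          (∈-⊕⁺ (complement∈gaps e₁ (m∸n+n≡m e≤F)) (deficit⊆sumset n dᵢ′ (m∸n+n≡m d≤nF)))
    where
    e≤F : e ≤ F
    e≤F = ≤-trans (deficit₁-≤ e₁) X≤F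
    d≤nF : d ≤ suc n * F
    d≤nF = ≤-trans (deficit-≤ n dᵢ′) (*-monoʳ-≤ (suc n) X≤F)
    x≡a+y : x ≡ (F ∸ e) + (suc n * F ∸ d)
    x≡a+y = x+[e+d]≡[a+e]+b⇒x≡a+[b∸d] (trans x+d≡F (cong (_+ suc n * F) (sym (m∸n+n≡m e≤F)))) d≤nF

  middleDeficits : List ℕ
  middleDeficits = interval u (suc X)

  largeDeficits : ℕ → List ℕ
  largeDeficits n = interval (u + u) (suc (n * X ⊓ R))

  deficits : ℕ → List ℕ
  deficits n = 0 ∷ middleDeficits ++ largeDeficits n

  ∈-deficits⁻ : ∀ n {d} → d ∈ deficits n → Deficit n d × d ≤ R
  ∈-deficits⁻ n (here refl) = inj₁ (inj₁ refl) , z≤n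
  ∈-deficits⁻ n (there d∈) with ∈-++⁻ middleDeficits d∈
  ... | inj₁ d∈₁ = let u≤d , d<1+X = ∈-interval⁻ u (suc X) d∈₁ in
                   inj₁ (inj₂ (u≤d , s≤s⁻¹ d<1+X)) , ≤-trans (s≤s⁻¹ d<1+X) X≤R
  ... | inj₂ d∈₂ = let u+u≤d , d<1+M = ∈-interval⁻ (u + u) (suc (n * X ⊓ R)) d∈₂ in
                   inj₂ (u+u≤d , ≤-trans (s≤s⁻¹ d<1+M) (m⊓n≤m _ R)) ,
                   ≤-trans (s≤s⁻¹ d<1+M) (m⊓n≤n _ R)

  ∈-deficits⁺ : ∀ n {d} → Deficit n d → d ≤ R → d ∈ deficits n
  ∈-deficits⁺ n (inj₁ (inj₁ refl))         _   = here refl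
  ∈-deficits⁺ n (inj₁ (inj₂ (u≤d , d≤X))) _   = there (∈-++⁺ˡ (∈-interval⁺ u≤d (s≤s d≤X)))
  ∈-deficits⁺ n (inj₂ (u+u≤d , d≤nX))    d≤R =
    there (∈-++⁺ʳ middleDeficits (∈-interval⁺ u+u≤d (s≤s (⊓-glb d≤nX d≤R))))

  deficits-unique : ∀ n → Unique (deficits n)
  deficits-unique n =
    All.tabulate 0∉ ∷ ++⁺ (interval-unique u (suc X)) (interval-unique (u + u) (suc (n * X ⊓ R))) disjoint
    where
    0∉ : ∀ {d} → d ∈ middleDeficits ++ largeDeficits n → 0 ≢ d
    0∉ d∈ refl with ∈-++⁻ middleDeficits d∈
    ... | inj₁ d∈₁ = contradiction (proj₁ (∈-interval⁻ u (suc X) d∈₁)) λ ()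
    ... | inj₂ d∈₂ = contradiction (proj₁ (∈-interval⁻ (u + u) (suc (n * X ⊓ R)) d∈₂)) λ ()
    disjoint : Disjoint middleDeficits (largeDeficits n)
    disjoint (d∈₁ , d∈₂) = <⇒≱ X<u+u (≤-trans (proj₁ (∈-interval⁻ (u + u) (suc (n * X ⊓ R)) d∈₂))
                                               (s≤s⁻¹ (proj₂ (∈-interval⁻ u (suc X) d∈₁))))

  nF+m+R≡[1+n]F : ∀ n → n * F + m + R ≡ suc n * F
  nF+m+R≡[1+n]F n = trans (+-assoc (n * F) m R) (trans (cong (n * F +_) (sym F≡m+R)) (+-comm (n * F) F))

  sumsetList : ℕ → List ℕ
  sumsetList n = interval (suc n) (n * F + m) ++ map (suc n * F ∸_) (deficits (suc n))

  ∈-deficits⇒≤nF : ∀ n {d} → d ∈ deficits (suc n) → d ≤ suc n * F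
  ∈-deficits⇒≤nF n d∈ = ≤-trans (proj₂ (∈-deficits⁻ (suc n) d∈)) (≤-trans R≤F (m≤m+n F (n * F)))

  ∈-sumsetList⁺ : ∀ n {x} → x ∈ suc n · gapList → x ∈ sumsetList n
  ∈-sumsetList⁺ n {x} x∈ with sumset-cases n x∈
  ... | inj₁ x<L = ∈-++⁺ˡ (∈-interval⁺ (sumset-≥ gap≥1 n x∈) x<L)
  ... | inj₂ (d , dᵢ , x+d≡nF) with d ≤? R
  ...   | yes d≤R = ∈-++⁺ʳ (interval (suc n) (n * F + m))
                      (subst (_∈ map (suc n * F ∸_) (deficits (suc n))) nF∸d≡x
                        (∈-map⁺ (suc n * F ∸_) (∈-deficits⁺ (suc n) dᵢ d≤R)))
    where
    nF∸d≡x : suc n * F ∸ d ≡ x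
    nF∸d≡x = trans (cong (_∸ d) (sym x+d≡nF)) (m+n∸n≡m x d)
  ...   | no d≰R = ∈-++⁺ˡ (∈-interval⁺ (sumset-≥ gap≥1 n x∈) x<L)
    where
    x<L : x < n * F + m
    x<L = +-cancelʳ-< R x (n * F + m)
      (subst (x + R <_) (trans x+d≡nF (sym (nF+m+R≡[1+n]F n))) (+-monoʳ-< x (≰⇒> d≰R)))

  ∈-sumsetList⁻ : ∀ n {x} → x ∈ sumsetList n → x ∈ suc n · gapList
  ∈-sumsetList⁻ n x∈ with ∈-++⁻ (interval (suc n) (n * F + m)) x∈
  ... | inj₁ x∈low = let n<x , x<L = ∈-interval⁻ (suc n) (n * F + m) x∈low in
                     interval⊆sumset low⊆gaps F∈gaps 1≤F F+2≤m+m n n<x x<L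
  ... | inj₂ x∈top with ∈-map⁻ (suc n * F ∸_) {xs = deficits (suc n)} x∈top
  ...   | d , d∈ , refl =
          deficit⊆sumset n (proj₁ (∈-deficits⁻ (suc n) d∈)) (m∸n+n≡m (∈-deficits⇒≤nF n d∈))

  sumsetList-unique : ∀ n → Unique (sumsetList n)
  sumsetList-unique n = ++⁺ (interval-unique (suc n) (n * F + m))
    (map-∸-unique (All.tabulate (∈-deficits⇒≤nF n)) (deficits-unique (suc n))) low∩top
    where
    low∩top : Disjoint (interval (suc n) (n * F + m)) (map (suc n * F ∸_) (deficits (suc n)))
    low∩top (x∈low , x∈top) with ∈-map⁻ (suc n * F ∸_) {xs = deficits (suc n)} x∈top
    ... | d , d∈ , refl = <⇒≱ (proj₂ (∈-interval⁻ (suc n) (n * F + m) x∈low))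
          (subst (_≤ suc n * F ∸ d) nF∸R≡L (∸-monoʳ-≤ (suc n * F) (proj₂ (∈-deficits⁻ (suc n) d∈))))
      where
      nF∸R≡L : suc n * F ∸ R ≡ n * F + m
      nF∸R≡L = trans (cong (_∸ R) (sym (nF+m+R≡[1+n]F n))) (m+n∸n≡m (n * F + m) R)

  |sumset|≡ : ∀ n → card (suc n · gapList) ≡
              (n * F + m ∸ suc n) + suc ((suc X ∸ u) + (suc (suc n * X ⊓ R) ∸ (u + u)))
  |sumset|≡ n = begin
    card (suc n · gapList)
      ≡⟨ card-≡-length (sumsetList-unique n) (mk⇔ (∈-sumsetList⁺ n) (∈-sumsetList⁻ n)) ⟩
    length (sumsetList n)
      ≡⟨ length-++ (interval (suc n) (n * F + m)) ⟩
    length (interval (suc n) (n * F + m)) + length (map (suc n * F ∸_) (deficits (suc n)))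
      ≡⟨ cong₂ _+_ (length-interval (suc n) (n * F + m)) (length-map (suc n * F ∸_) (deficits (suc n))) ⟩
    (n * F + m ∸ suc n) + suc (length (middleDeficits ++ largeDeficits (suc n)))
      ≡⟨ cong (λ l → (n * F + m ∸ suc n) + suc l) (length-++ middleDeficits) ⟩
    (n * F + m ∸ suc n) + suc (length middleDeficits + length (largeDeficits (suc n)))
      ≡⟨ cong₂ (λ l₁ l₂ → (n * F + m ∸ suc n) + suc (l₁ + l₂))
               (length-interval u (suc X)) (length-interval (u + u) (suc (suc n * X ⊓ R))) ⟩
    (n * F + m ∸ suc n) + suc ((suc X ∸ u) + (suc (suc n * X ⊓ R) ∸ (u + u))) ∎
    where open ≡-Reasoning

  |sumset|-excess : ∀ n → let N = 2 + n in
    card (N · gapList) + (3 * N + 1) * w ≡ suc (2 * suc n) * (m + w) + N * X ⊓ R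
  |sumset|-excess n = +-cancelʳ-≡ (N + (u + u)) _ _ (begin
    card (N · gapList) + K + (N + (u + u))
      ≡⟨ cong (λ l → l + K + (N + (u + u))) (|sumset|≡ (suc n)) ⟩
    (L ∸ N) + suc ((suc X ∸ u) + (suc M ∸ (u + u))) + K + (N + (u + u))
      ≡⟨ regroup (L ∸ N) (suc X ∸ u) (suc M ∸ (u + u)) K N (u + u) ⟩
    ((L ∸ N) + N) + suc (suc X ∸ u) + ((suc M ∸ (u + u)) + (u + u)) + K
      ≡⟨ cong₃ (λ a b c → a + suc b + c + K) (m∸n+n≡m N≤L) |[u,X]|≡1+w (m∸n+n≡m u+u≤1+M) ⟩
    L + suc (suc w) + suc M + K
      ≡⟨ identity n w c M ⟩
    suc (2 * suc n) * (m + w) + M + (N + (u + u)) ∎)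
    where
    open ≡-Reasoning
    N = 2 + n
    K = (3 * N + 1) * w
    L = suc n * F + m
    M = N * X ⊓ R
    cong₃ : ∀ {a b c a′ b′ c′ : ℕ} (f : ℕ → ℕ → ℕ → ℕ) →
            a ≡ a′ → b ≡ b′ → c ≡ c′ → f a b c ≡ f a′ b′ c′
    cong₃ f refl refl refl = refl
    regroup : ∀ A B₁ B₂ K N U → A + suc (B₁ + B₂) + K + (N + U) ≡ (A + N) + suc B₁ + (B₂ + U) + K
    regroup = solve-∀
    identity : ∀ n w c M →
      let u = suc (2 * w); X = u + w; m = c + 4 * w; F = m + c + X; N = 2 + n in
      (suc n * F + m) + suc (suc w) + suc M + (3 * N + 1) * w ≡ suc (2 * suc n) * (m + w) + M + (N + (u + u))
    identity = solve-∀
    N≤L : N ≤ L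
    N≤L = subst (_≤ L) (+-comm (suc n) 1)
      (+-mono-≤ (subst (_≤ suc n * F) (*-identityʳ (suc n)) (*-monoʳ-≤ (suc n) 1≤F)) 1≤m)
    |[u,X]|≡1+w : suc X ∸ u ≡ suc w
    |[u,X]|≡1+w = trans (cong (_∸ u) (sym (+-suc u w))) (m+n∸m≡n u (suc w))
    u+u≤NX : u + u ≤ N * X
    u+u≤NX = ≤-trans (+-mono-≤ u≤X u≤X) (+-monoʳ-≤ X (m≤m+n X (n * X)))
    u+u≤1+M : u + u ≤ suc M
    u+u≤1+M = ≤-trans (⊓-glb u+u≤NX u+u≤R) (n≤1+n M)

  inBuchweitz⇔ : ∀ n → InBuchweitz semigroup (2 + n) ⇔ (3 * (2 + n) + 1) * w < (2 + n) * X ⊓ R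
  inBuchweitz⇔ n = a+c≡b+d⇒b<a⇔c<d (|sumset|-excess n) ⇔-∘ inBuchweitz⇔bound<card semigroup n |gaps|≡1+m+w

[3n+1]w<n[3w+1]⇔w<n : ∀ w n → (3 * n + 1) * w < n * (suc (2 * w) + w) ⇔ w < n
[3n+1]w<n[3w+1]⇔w<n w n = mk⇔
  (λ lt → +-cancelˡ-< (3 * n * w) w n (subst₂ _<_ (e₁ w n) (e₂ w n) lt))
  (λ w<n → subst₂ _<_ (sym (e₁ w n)) (sym (e₂ w n)) (+-monoʳ-< (3 * n * w) w<n))
  where
  e₁ : ∀ w n → (3 * n + 1) * w ≡ 3 * n * w + w
  e₁ = solve-∀
  e₂ : ∀ w n → n * (suc (2 * w) + w) ≡ 3 * n * w + n
  e₂ = solve-∀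

module Instance (k : ℕ) where

  w c : ℕ
  w = 6 + 2 * k
  -- chosen so that R = w(22 + 12k) + 1
  c = w * (19 + 12 * k)

  w<c : w < c
  w<c = subst (suc w ≤_) (sym (c≡ k)) (m≤m+n (suc w) _)
    where
    c≡ : ∀ k → (6 + 2 * k) * (19 + 12 * k) ≡ suc (6 + 2 * k) + (107 + 108 * k + 24 * (k * k))
    c≡ = solve-∀

  open Construction w c (s≤s (s≤s (s≤s z≤n))) w<c public

  [3n+1]w<R⇔n≤7+4k : ∀ n → (3 * n + 1) * w < R ⇔ n ≤ 7 + 4 * k
  [3n+1]w<R⇔n≤7+4k n = begin
    (3 * n + 1) * w < R                           ≡⟨ cong ((3 * n + 1) * w <_) (R≡ k) ⟩
    (3 * n + 1) * w < suc ((22 + 12 * k) * w)     ∼⟨ mk⇔ s≤s⁻¹ s≤s ⟩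
    (3 * n + 1) * w ≤ (22 + 12 * k) * w           ∼⟨ mk⇔ (*-cancelʳ-≤ _ _ w) (*-monoˡ-≤ w) ⟩
    3 * n + 1 ≤ 22 + 12 * k                       ≡⟨ cong (3 * n + 1 ≤_) (22+12k≡ k) ⟩
    3 * n + 1 ≤ 3 * (7 + 4 * k) + 1               ∼⟨ mk⇔ (+-cancelʳ-≤ 1 _ _) (+-monoˡ-≤ 1) ⟩
    3 * n ≤ 3 * (7 + 4 * k)                       ∼⟨ mk⇔ (*-cancelˡ-≤ 3) (*-monoʳ-≤ 3) ⟩
    n ≤ 7 + 4 * k                                 ∎
    where
    open EquationalReasoning
    R≡ : ∀ k → let w = 6 + 2 * k in w * (19 + 12 * k) + (suc (2 * w) + w) ≡ suc ((22 + 12 * k) * w)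
    R≡ = solve-∀
    22+12k≡ : ∀ k → 22 + 12 * k ≡ 3 * (7 + 4 * k) + 1
    22+12k≡ = solve-∀

proposition3p7 : ∀ (k : ℕ) → 1 ≤ k →
    Σ NumericalSemigroup λ S →
      ∀ (n : ℕ) → InBuchweitz S n ⇔ ((7 + 2 * k ≤ n) × (n ≤ 7 + 4 * k))
-- The construction also works for k = 0.
proposition3p7 k _ = semigroup , buchweitz
  where
  open Instance k
  buchweitz : ∀ n → InBuchweitz semigroup n ⇔ ((7 + 2 * k ≤ n) × (n ≤ 7 + 4 * k))
  buchweitz 0 = mk⇔ (λ { (() , _) }) λ { (() , _) }
  buchweitz 1 = mk⇔ (λ { (s≤s () , _) }) λ { (s≤s () , _) }
  buchweitz (suc (suc n)) = begin
    InBuchweitz semigroup (2 + n)                                       ∼⟨ inBuchweitz⇔ n ⟩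
    (3 * (2 + n) + 1) * w < (2 + n) * X ⊓ R                             ∼⟨ <-⊓⇔ ⟩
    (((3 * (2 + n) + 1) * w < (2 + n) * X) × ((3 * (2 + n) + 1) * w < R))
                          ∼⟨ [3n+1]w<n[3w+1]⇔w<n w (2 + n) ×-⇔ [3n+1]w<R⇔n≤7+4k (2 + n) ⟩
    ((w < 2 + n) × (2 + n ≤ 7 + 4 * k))                                 ≡⟨⟩
    ((7 + 2 * k ≤ 2 + n) × (2 + n ≤ 7 + 4 * k))                         ∎
    where open EquationalReasoning
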